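{- Let $M$ be a matroid of rank $r$, and let $N$ be an adjoint of $M$ with ground set $E(N)=\mathcal{H}(M)$, identified so that some adjoint map $\phi:\mathcal{L}(M)\to\mathcal{L}(N)$ satisfies $\phi(H)=\{H\}$ for every $H\in\mathcal{H}(M)$. If $B$ is a basis of $M$, then $\{H(e;B)\mid e\in B\}$ is a basis of $N$.
   Context: All matroids are finite and nonempty. $\mathcal{L}(M)$ is the lattice of flats of $M$ and $\mathcal{H}(M)$ its set of hyperplanes. A matroid $N$ is an adjoint of $M$ if $r(N)=r(M)$ and there is an injective order-reversing map $\phi:\mathcal{L}(M)\to\mathcal{L}(N)$ (called an adjoint map) sending the coatoms of $\mathcal{L}(M)$ bijectively onto the atoms of $\mathcal{L}(N)$. For a basis $B$ of $M$ and $e\in B$, the fundamental hyperplane $H(e;B)$ is the unique hyperplane of $M$ containing $B\setminus\{e\}$. -}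

module Defs where

open import Data.Nat using (ℕ; suc; _≤_; _<_; _+_)
open import Data.Fin using (Fin)
open import Data.Fin.Subset using (Subset; _∈_; _∉_; _⊆_; _∪_; _∩_; _-_; ∣_∣; ⁅_⁆; ⊤)
open import Data.Sum using (_⊎_)
open import Data.Product using (Σ; _×_; _,_; ∃-syntax)
open import Relation.Binary.PropositionalEquality using (_≡_)
open import Relation.Nullary using (¬_)
open import Function.Bundles using (_⇔_)

record Matroid (n : ℕ) : Set where
  field
    rk        : Subset n → ℕ
    rk-bound  : ∀ X → rk X ≤ ∣ X ∣
    rk-mono   : ∀ {X Y} → X ⊆ Y → rk X ≤ rk Y
    rk-submod : ∀ X Y → rk (X ∪ Y) + rk (X ∩ Y) ≤ rk X + rk Y

module _ {n : ℕ} (M : Matroid n) where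
  open Matroid M

  rank : ℕ
  rank = rk ⊤

  Independent : Subset n → Set
  Independent I = rk I ≡ ∣ I ∣

  -- a basis is a maximal independent set, i.e. an independent set of full rank
  Basis : Subset n → Set
  Basis B = Independent B × rk B ≡ rank

  Flat : Subset n → Set
  Flat F = ∀ e → e ∉ F → rk F < rk (F ∪ ⁅ e ⁆)

  Hyperplane : Subset n → Set
  Hyperplane H = Flat H × suc (rk H) ≡ rank

  Coatom : Subset n → Set
  Coatom F = Flat F × ¬ (F ≡ ⊤) ×
    (∀ G → Flat G → F ⊆ G → G ≡ F ⊎ G ≡ ⊤)

  -- the bottom element of L(M) is the closure of the empty set, i.e. the
  -- least flat; an atom is a flat covering it.
  Atom : Subset n → Set
  Atom F = Flat F × (∃[ Z ] (Flat Z × (∀ G → Flat G → Z ⊆ G) × ¬ (F ≡ Z) × Z ⊆ F ×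
    (∀ G → Flat G → Z ⊆ G → G ⊆ F → G ≡ Z ⊎ G ≡ F)))

  -- H is the fundamental hyperplane H(e;B): the (unique) hyperplane containing B ∖ {e}
  IsFundHyp : Subset n → Fin n → Subset n → Set
  IsFundHyp B e H = Hyperplane H × (B - e) ⊆ H

-- φ : L(M) → L(N) is an adjoint map (given as a function on subsets, only its
-- restriction to flats matters)
record AdjointMap {n m : ℕ} (M : Matroid n) (N : Matroid m)
                  (φ : Subset n → Subset m) : Set where
  field
    flat↦flat    : ∀ F → Flat M F → Flat N (φ F)
    injective    : ∀ F G → Flat M F → Flat M G → φ F ≡ φ G → F ≡ G
    antitone     : ∀ F G → Flat M F → Flat M G → F ⊆ G → φ G ⊆ φ F
    coatom↦atom  : ∀ F → Coatom M F → Atom N (φ F)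
    atom-onto    : ∀ A → Atom N A → ∃[ F ] (Coatom M F × φ F ≡ A)

IsAdjointVia : {n m : ℕ} (M : Matroid n) (N : Matroid m) (φ : Subset n → Subset m) → Set
IsAdjointVia M N φ = rank N ≡ rank M × AdjointMap M N φ

{-# OPTIONS --safe #-}
-- Write r for the common rank, ⋂K for the intersection of the hyperplanes
-- indexed by K ⊆ S, and e_k ∈ B for the element with H(e_k;B) = h k. As h k
-- contains all of B but e_k, r ≤ r(⋂K) + |K|. The chain of flats from the
-- least flat up to ⋂K is mapped by the injective antitone φ onto a strict
-- chain in N, so r_N(φ(⋂K)) ≤ r - r(⋂K) ≤ |K|; moreover K ⊆ φ(⋂K). One
-- shows |I| ≤ r_N(I) for I ⊆ S by induction: if it failed for I, then for
-- two indices i ≠ j of I both φ(⋂(I - i)) and φ(⋂(I - j)) would be flats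
-- containing I of rank at most r_N(I), hence equal, so ⋂(I - i) = ⋂(I - j)
-- by injectivity of φ; but e_i lies in the first and not in the second.
-- Finally every e ∈ B avoids its own fundamental hyperplane, so ⋂S misses
-- B and r ≤ |S|.
module Submission where

open import Defs
open import Data.Nat using (ℕ; zero; suc; _≤_; _<_; _+_; z≤n; s≤s; z<s; _≤?_)
open import Data.Nat.Properties hiding (_≟_)
open import Data.Fin using (Fin; zero; suc; _≟_)
open import Data.Fin.Properties using (all?; any?)
open import Data.Fin.Subset
open import Data.Fin.Subset.Properties
open import Data.Vec.Base using (tabulate; _∷_; here; there)
open import Data.Vec.Properties using (lookup∘tabulate; []=⇒lookup; lookup⇒[]=)
open import Data.Product using (_×_; _,_; ∃-syntax; proj₁; proj₂)
open import Data.Sum using (inj₁; inj₂)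
open import Data.Empty using (⊥-elim)
open import Relation.Binary.PropositionalEquality
open import Relation.Nullary using (Dec; yes; no; does; ¬_)
open import Relation.Nullary.Decidable using (dec-true; decidable-stable; _×-dec_; ¬?; _→-dec_)
open import Function.Bundles using (_⇔_; Equivalence)

x∈p─q⇒x∉q : ∀ {n} (p q : Subset n) {x} → x ∈ p ─ q → x ∉ q
x∈p─q⇒x∉q (_ ∷ p) (inside ∷ q) {zero} () here
x∈p─q⇒x∉q (_ ∷ p) (outside ∷ q) {zero} _ ()
x∈p─q⇒x∉q (_ ∷ p) (_ ∷ q) {suc x} (there x∈) (there x∈q) = x∈p─q⇒x∉q p q x∈ x∈q

module _ {n : ℕ} where

  filter : {P : Fin n → Set} → (∀ x → Dec (P x)) → Subset n
  filter P? = tabulate (λ x → does (P? x))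

  ∈-filter⁺ : {P : Fin n → Set} (P? : ∀ x → Dec (P x)) {x : Fin n} → P x → x ∈ filter P?
  ∈-filter⁺ P? {x} px = lookup⇒[]= x _ (trans (lookup∘tabulate _ x) (dec-true (P? x) px))

  ∈-filter⁻ : {P : Fin n → Set} (P? : ∀ x → Dec (P x)) {x : Fin n} → x ∈ filter P? → P x
  ∈-filter⁻ P? {x} x∈ with P? x | trans (sym (lookup∘tabulate _ x)) ([]=⇒lookup x∈)
  ... | yes px | _ = px
  ... | no _   | ()

  ∪-least : {p q r : Subset n} → p ⊆ r → q ⊆ r → p ∪ q ⊆ r
  ∪-least {p} {q} p⊆r q⊆r x∈ with x∈p∪q⁻ p q x∈
  ... | inj₁ x∈p = p⊆r x∈p
  ... | inj₂ x∈q = q⊆r x∈q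

  ⁅x⁆⊆p : {x : Fin n} {p : Subset n} → x ∈ p → ⁅ x ⁆ ⊆ p
  ⁅x⁆⊆p {x} x∈p y∈ with x∈⁅y⁆⇒x≡y _ y∈
  ... | refl = x∈p

  p⊆p-x∪⁅x⁆ : (p : Subset n) (x : Fin n) → p ⊆ (p - x) ∪ ⁅ x ⁆
  p⊆p-x∪⁅x⁆ p x {y} y∈p with y ≟ x
  ... | yes refl = q⊆p∪q (p - x) ⁅ x ⁆ (x∈⁅x⁆ x)
  ... | no y≢x = p⊆p∪q ⁅ x ⁆ (x∈p∧x≢y⇒x∈p-y y∈p y≢x)

  x∈p-y⇒x≢y : {p : Subset n} {x y : Fin n} → x ∈ p - y → x ≢ y
  x∈p-y⇒x≢y {p} {y = y} x∈ refl = x∈p─q⇒x∉q p ⁅ y ⁆ x∈ (x∈⁅x⁆ y)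

  ⊈⇒∃∈∉ : {p q : Subset n} → p ⊈ q → ∃[ x ] (x ∈ p × x ∉ q)
  ⊈⇒∃∈∉ {p} {q} p⊈q with any? (λ x → (x ∈? p) ×-dec ¬? (x ∈? q))
  ... | yes witness = witness
  ... | no none = ⊥-elim (p⊈q λ {x} x∈p → decidable-stable (x ∈? q) (λ x∉q → none (x , x∈p , x∉q)))

∣p∣≡1+∣p-x∣ : ∀ {n} (p : Subset n) {x} → x ∈ p → ∣ p ∣ ≡ suc ∣ p - x ∣
∣p∣≡1+∣p-x∣ (inside ∷ p) {zero} here = cong suc (sym (cong ∣_∣ (p─⊥≡p p)))
∣p∣≡1+∣p-x∣ (inside ∷ p) {suc x} (there x∈p) = cong suc (∣p∣≡1+∣p-x∣ p x∈p)
∣p∣≡1+∣p-x∣ (outside ∷ p) {suc x} (there x∈p) = ∣p∣≡1+∣p-x∣ p x∈p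

∣p∣≡0⇒x∉p : ∀ {n} {p : Subset n} {x} → ∣ p ∣ ≡ 0 → x ∉ p
∣p∣≡0⇒x∉p {p = p} ∣p∣≡0 x∈p = 0≢1+n (trans (sym ∣p∣≡0) (∣p∣≡1+∣p-x∣ p x∈p))

∣p∣≡1+k⇒∃x∈p∣p-x∣≡k : ∀ {n k} (p : Subset n) → ∣ p ∣ ≡ suc k → ∃[ x ] (x ∈ p × ∣ p - x ∣ ≡ k)
∣p∣≡1+k⇒∃x∈p∣p-x∣≡k {n} p ∣p∣≡1+k with nonempty? p
... | yes (x , x∈p) = x , x∈p , suc-injective (trans (sym (∣p∣≡1+∣p-x∣ p x∈p)) ∣p∣≡1+k)
... | no empty = ⊥-elim (0≢1+n (trans (sym (∣⊥∣≡0 n)) (trans (cong ∣_∣ (sym (Empty-unique empty))) ∣p∣≡1+k)))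

∈⋂? : ∀ {m n} (h : Fin m → Subset n) (K : Subset m) x → Dec (∀ k → k ∈ K → x ∈ h k)
∈⋂? h K x = all? (λ k → (k ∈? K) →-dec (x ∈? h k))

⋂ᶠ : ∀ {m n} → (Fin m → Subset n) → Subset m → Subset n
⋂ᶠ h K = filter (∈⋂? h K)

module _ {m n : ℕ} (h : Fin m → Subset n) {K : Subset m} where

  ∈⋂ᶠ⁺ : ∀ {x} → (∀ k → k ∈ K → x ∈ h k) → x ∈ ⋂ᶠ h K
  ∈⋂ᶠ⁺ = ∈-filter⁺ (∈⋂? h K)

  ⋂ᶠ⊆ : ∀ {k} → k ∈ K → ⋂ᶠ h K ⊆ h k
  ⋂ᶠ⊆ k∈K x∈ = ∈-filter⁻ (∈⋂? h K) x∈ _ k∈K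

module MatroidProperties {n : ℕ} (M : Matroid n) where
  open Matroid M

  rk[⊥]≡0 : rk ⊥ ≡ 0
  rk[⊥]≡0 = n≤0⇒n≡0 (subst (rk ⊥ ≤_) (∣⊥∣≡0 n) (rk-bound ⊥))

  rk-∪⁅x⁆≤1+rk : ∀ X x → rk (X ∪ ⁅ x ⁆) ≤ suc (rk X)
  rk-∪⁅x⁆≤1+rk X x = begin
    rk (X ∪ ⁅ x ⁆)                   ≤⟨ m≤m+n _ _ ⟩
    rk (X ∪ ⁅ x ⁆) + rk (X ∩ ⁅ x ⁆)  ≤⟨ rk-submod X ⁅ x ⁆ ⟩
    rk X + rk ⁅ x ⁆                  ≤⟨ +-monoʳ-≤ (rk X) (subst (rk ⁅ x ⁆ ≤_) (∣⁅x⁆∣≡1 x) (rk-bound ⁅ x ⁆)) ⟩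
    rk X + 1                         ≡⟨ +-comm (rk X) 1 ⟩
    suc (rk X)                       ∎
    where open ≤-Reasoning

  rk≤1+rk[-] : ∀ X x → rk X ≤ suc (rk (X - x))
  rk≤1+rk[-] X x = ≤-trans (rk-mono (p⊆p-x∪⁅x⁆ X x)) (rk-∪⁅x⁆≤1+rk (X - x) x)

  rk-∪≤rk : ∀ {X Y Z} → Z ⊆ X → Z ⊆ Y → rk Y ≤ rk Z → rk (X ∪ Y) ≤ rk X
  rk-∪≤rk {X} {Y} {Z} Z⊆X Z⊆Y rkY≤rkZ = +-cancelʳ-≤ (rk Z) _ _ (begin
    rk (X ∪ Y) + rk Z        ≤⟨ +-monoʳ-≤ (rk (X ∪ Y)) (rk-mono (λ z∈Z → x∈p∩q⁺ (Z⊆X z∈Z , Z⊆Y z∈Z))) ⟩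
    rk (X ∪ Y) + rk (X ∩ Y)  ≤⟨ rk-submod X Y ⟩
    rk X + rk Y              ≤⟨ +-monoʳ-≤ (rk X) rkY≤rkZ ⟩
    rk X + rk Z              ∎)
    where open ≤-Reasoning

  ∈-flat : ∀ {F X x} → Flat M F → X ⊆ F → rk (X ∪ ⁅ x ⁆) ≤ rk X → x ∈ F
  ∈-flat {F} {X} {x} flatF X⊆F rk≤ = decidable-stable (x ∈? F) λ x∉F →
    <⇒≱ (flatF x x∉F)
      (≤-trans (rk-mono (∪-least (p⊆p∪q _) (λ x∈ → q⊆p∪q F _ (q⊆p∪q X _ x∈))))
               (rk-∪≤rk X⊆F (p⊆p∪q _) rk≤))

  rk≤⇒⊆-flat : ∀ {F X Y} → Flat M F → X ⊆ F → X ⊆ Y → rk Y ≤ rk X → Y ⊆ F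
  rk≤⇒⊆-flat flatF X⊆F X⊆Y rkY≤rkX y∈Y =
    ∈-flat flatF X⊆F (≤-trans (rk-mono (∪-least X⊆Y (⁅x⁆⊆p y∈Y))) rkY≤rkX)

  flats-⊇-of-rk≤-unique : ∀ {F F′ X} → Flat M F → Flat M F′ → X ⊆ F → X ⊆ F′ →
    rk F ≤ rk X → rk F′ ≤ rk X → F ≡ F′
  flats-⊇-of-rk≤-unique flatF flatF′ X⊆F X⊆F′ rkF≤ rkF′≤ =
    ⊆-antisym (rk≤⇒⊆-flat flatF′ X⊆F′ X⊆F rkF≤) (rk≤⇒⊆-flat flatF X⊆F X⊆F′ rkF′≤)

  flat-⊂⇒rk< : ∀ {F X} → Flat M F → F ⊆ X → F ≢ X → rk F < rk X
  flat-⊂⇒rk< {F} {X} flatF F⊆X F≢X with ⊈⇒∃∈∉ (λ X⊆F → F≢X (⊆-antisym F⊆X X⊆F))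
  ... | x , x∈X , x∉F = ≤-trans (flatF x x∉F) (rk-mono (∪-least F⊆X (⁅x⁆⊆p x∈X)))

  ⊤-flat : Flat M ⊤
  ⊤-flat x x∉⊤ = ⊥-elim (x∉⊤ ∈⊤)

  ⋂ᶠ-flat : ∀ {m} {h : Fin m → Subset n} → (∀ k → Flat M (h k)) → ∀ K → Flat M (⋂ᶠ h K)
  ⋂ᶠ-flat {h = h} flat K x x∉⋂ = ≰⇒> λ rk≤ → x∉⋂ (∈⋂ᶠ⁺ h λ k k∈K → ∈-flat (flat k) (⋂ᶠ⊆ h k∈K) rk≤)

  rk-∪-absorbed : ∀ X Y → (∀ {y} → y ∈ Y → rk (X ∪ ⁅ y ⁆) ≤ rk X) → rk (X ∪ Y) ≤ rk X
  rk-∪-absorbed X Y = go _ Y refl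
    where
    go : ∀ k Y → ∣ Y ∣ ≡ k → (∀ {y} → y ∈ Y → rk (X ∪ ⁅ y ⁆) ≤ rk X) → rk (X ∪ Y) ≤ rk X
    go zero Y ∣Y∣≡0 _ = rk-mono (∪-least ⊆-refl (λ y∈Y → ⊥-elim (∣p∣≡0⇒x∉p ∣Y∣≡0 y∈Y)))
    go (suc k) Y ∣Y∣≡1+k absorbed with ∣p∣≡1+k⇒∃x∈p∣p-x∣≡k Y ∣Y∣≡1+k
    ... | y , y∈Y , ∣Y-y∣≡k = begin
      rk (X ∪ Y)                              ≤⟨ rk-mono Y-split ⟩
      rk ((X ∪ (Y - y)) ∪ (X ∪ ⁅ y ⁆))        ≤⟨ rk-∪≤rk (p⊆p∪q _) (p⊆p∪q _) (absorbed y∈Y) ⟩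
      rk (X ∪ (Y - y))                        ≤⟨ go k (Y - y) ∣Y-y∣≡k (λ z∈ → absorbed (p─q⊆p Y _ z∈)) ⟩
      rk X                                    ∎
      where
      open ≤-Reasoning
      Y-split : X ∪ Y ⊆ (X ∪ (Y - y)) ∪ (X ∪ ⁅ y ⁆)
      Y-split = ∪-least (λ x∈X → p⊆p∪q _ (p⊆p∪q _ x∈X))
        (λ z∈Y → ∪-least (λ z∈ → p⊆p∪q _ (q⊆p∪q X _ z∈)) (λ z∈ → q⊆p∪q _ _ (q⊆p∪q X _ z∈))
                          (p⊆p-x∪⁅x⁆ Y y z∈Y))

  ∈cl? : ∀ X x → Dec (rk (X ∪ ⁅ x ⁆) ≤ rk X)
  ∈cl? X x = rk (X ∪ ⁅ x ⁆) ≤? rk X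

  cl : Subset n → Subset n
  cl X = filter (∈cl? X)

  ⊆-cl : ∀ X → X ⊆ cl X
  ⊆-cl X x∈X = ∈-filter⁺ (∈cl? X) (rk-mono (∪-least ⊆-refl (⁅x⁆⊆p x∈X)))

  rk-cl : ∀ X → rk (cl X) ≡ rk X
  rk-cl X = ≤-antisym
    (≤-trans (rk-mono (q⊆p∪q X _)) (rk-∪-absorbed X (cl X) (∈-filter⁻ (∈cl? X))))
    (rk-mono (⊆-cl X))

  cl-flat : ∀ X → Flat M (cl X)
  cl-flat X x x∉cl = begin-strict
    rk (cl X)       ≡⟨ rk-cl X ⟩
    rk X            <⟨ ≰⇒> (λ rk≤ → x∉cl (∈-filter⁺ (∈cl? X) rk≤)) ⟩
    rk (X ∪ ⁅ x ⁆)  ≤⟨ rk-mono (∪-least (λ y∈ → p⊆p∪q _ (⊆-cl X y∈)) (q⊆p∪q _ _)) ⟩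
    rk (cl X ∪ ⁅ x ⁆) ∎
    where open ≤-Reasoning

  cl-least : ∀ {X F} → Flat M F → X ⊆ F → cl X ⊆ F
  cl-least {X} flatF X⊆F x∈cl = ∈-flat flatF X⊆F (∈-filter⁻ (∈cl? X) x∈cl)

  rk≤rk[⋂ᶠ∩]+∣∣ : ∀ {m} (h : Fin m → Subset n) X K → (∀ {k} → k ∈ K → ∃[ e ] (X - e ⊆ h k)) →
    rk X ≤ rk (⋂ᶠ h K ∩ X) + ∣ K ∣
  rk≤rk[⋂ᶠ∩]+∣∣ h X K = go _ K refl
    where
    go : ∀ c K → ∣ K ∣ ≡ c → (∀ {k} → k ∈ K → ∃[ e ] (X - e ⊆ h k)) → rk X ≤ rk (⋂ᶠ h K ∩ X) + c
    go zero K ∣K∣≡0 _ = ≤-trans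
      (rk-mono (λ x∈X → x∈p∩q⁺ (∈⋂ᶠ⁺ h {K} (λ k k∈K → ⊥-elim (∣p∣≡0⇒x∉p ∣K∣≡0 k∈K)) , x∈X)))
      (m≤m+n _ 0)
    go (suc c) K ∣K∣≡1+c misses with ∣p∣≡1+k⇒∃x∈p∣p-x∣≡k K ∣K∣≡1+c
    ... | j , j∈K , ∣K-j∣≡c with misses j∈K
    ...   | e , X-e⊆hj = begin
      rk X                                ≤⟨ go c (K - j) ∣K-j∣≡c (λ k∈ → misses (p─q⊆p K _ k∈)) ⟩
      rk (⋂ᶠ h (K - j) ∩ X) + c           ≤⟨ +-monoˡ-≤ c (rk≤1+rk[-] _ e) ⟩
      suc (rk (⋂ᶠ h (K - j) ∩ X - e)) + c ≤⟨ +-monoˡ-≤ c (s≤s (rk-mono one-more)) ⟩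
      suc (rk (⋂ᶠ h K ∩ X)) + c           ≡⟨ +-suc _ c ⟨
      rk (⋂ᶠ h K ∩ X) + suc c             ∎
      where
      open ≤-Reasoning
      one-more : ⋂ᶠ h (K - j) ∩ X - e ⊆ ⋂ᶠ h K ∩ X
      one-more {x} x∈ with x∈p∩q⁻ (⋂ᶠ h (K - j)) X (p─q⊆p _ _ x∈)
      ... | x∈⋂ , x∈X = x∈p∩q⁺ (∈⋂ᶠ⁺ h in-each , x∈X)
        where
        in-each : ∀ k → k ∈ K → x ∈ h k
        in-each k k∈K with k ≟ j
        ... | yes refl = X-e⊆hj (x∈p∧x≢y⇒x∈p-y x∈X (x∈p-y⇒x≢y x∈))
        ... | no k≢j = ⋂ᶠ⊆ h (x∈p∧x≢y⇒x∈p-y k∈K k≢j) x∈⋂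

  module _ {B : Subset n} (rk[B]≡rank : rk B ≡ rank M) where

    fundamental-hyperplane-unique : ∀ {e H H′} → IsFundHyp M B e H → IsFundHyp M B e H′ → H ≡ H′
    fundamental-hyperplane-unique {e} fund fund′ = ⊆-antisym (⊆-other fund fund′) (⊆-other fund′ fund)
      where
      ⊆-other : ∀ {H H′} → IsFundHyp M B e H → IsFundHyp M B e H′ → H ⊆ H′
      ⊆-other ((_ , 1+rk[H]≡rank) , B-e⊆H) ((flatH′ , _) , B-e⊆H′) =
        rk≤⇒⊆-flat flatH′ B-e⊆H′ B-e⊆H
          (≤-pred (subst (_≤ suc (rk (B - e))) (trans rk[B]≡rank (sym 1+rk[H]≡rank)) (rk≤1+rk[-] B e)))

    ∉-fundamental-hyperplane : ∀ {e H} → IsFundHyp M B e H → e ∉ H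
    ∉-fundamental-hyperplane {e} {H} ((_ , 1+rk[H]≡rank) , B-e⊆H) e∈H = <⇒≱ rk[H]<rk[B] rk[B]≤rk[H]
      where
      rk[H]<rk[B] : rk H < rk B
      rk[H]<rk[B] = ≤-reflexive (trans 1+rk[H]≡rank (sym rk[B]≡rank))
      rk[B]≤rk[H] : rk B ≤ rk H
      rk[B]≤rk[H] = rk-mono (λ x∈B → ∪-least B-e⊆H (⁅x⁆⊆p e∈H) (p⊆p-x∪⁅x⁆ B e x∈B))

  cl-fundamental-hyperplane : ∀ {B e} → Basis M B → e ∈ B → IsFundHyp M B e (cl (B - e))
  cl-fundamental-hyperplane {B} {e} (independent , rk[B]≡rank) e∈B =
    (cl-flat (B - e) , trans (cong suc (rk-cl (B - e))) (≤-antisym upper lower)) , ⊆-cl (B - e)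
    where
    upper : suc (rk (B - e)) ≤ rank M
    upper = begin
      suc (rk (B - e))   ≤⟨ s≤s (rk-bound (B - e)) ⟩
      suc ∣ B - e ∣      ≡⟨ ∣p∣≡1+∣p-x∣ B e∈B ⟨
      ∣ B ∣              ≡⟨ trans (sym independent) rk[B]≡rank ⟩
      rank M             ∎
      where open ≤-Reasoning
    lower : rank M ≤ suc (rk (B - e))
    lower = subst (_≤ suc (rk (B - e))) rk[B]≡rank (rk≤1+rk[-] B e)

module AdjointMapProperties {n m : ℕ} {M : Matroid n} {N : Matroid m} {φ : Subset n → Subset m}
                            (adjoint : AdjointMap M N φ) where
  open AdjointMap adjoint
  open Matroid M using () renaming (rk to rkᴹ; rk-mono to rkᴹ-mono)
  open Matroid N using () renaming (rk to rkᴺ; rk-mono to rkᴺ-mono)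
  private
    module Mᵖ = MatroidProperties M
    module Nᵖ = MatroidProperties N

  rk-φ-chain : ∀ d {G F} → Flat M G → Flat M F → G ⊆ F → rkᴹ G + d ≡ rkᴹ F → rkᴺ (φ F) + d ≤ rkᴺ (φ G)
  rk-φ-chain zero {G} {F} flatG flatF G⊆F _ =
    ≤-trans (≤-reflexive (+-identityʳ _)) (rkᴺ-mono (antitone G F flatG flatF G⊆F))
  rk-φ-chain (suc d) {G} {F} flatG flatF G⊆F rk≡ = via-cover (⊈⇒∃∈∉ F⊈G)
    where
    F⊈G : F ⊈ G
    F⊈G F⊆G = <⇒≱ (≤-trans (m<m+n (rkᴹ G) z<s) (≤-reflexive rk≡)) (rkᴹ-mono F⊆G)
    via-cover : ∃[ x ] (x ∈ F × x ∉ G) → rkᴺ (φ F) + suc d ≤ rkᴺ (φ G)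
    via-cover (x , x∈F , x∉G) = begin
      rkᴺ (φ F) + suc d    ≡⟨ +-suc _ d ⟩
      suc (rkᴺ (φ F) + d)  ≤⟨ s≤s (rk-φ-chain d flatG′ flatF G′⊆F rk[G′]+d≡rk[F]) ⟩
      suc (rkᴺ (φ G′))     ≤⟨ Nᵖ.flat-⊂⇒rk< (flat↦flat G′ flatG′) (antitone G G′ flatG flatG′ G⊆G′) φG′≢φG ⟩
      rkᴺ (φ G)            ∎
      where
      open ≤-Reasoning
      G′ : Subset n
      G′ = Mᵖ.cl (G ∪ ⁅ x ⁆)
      flatG′ : Flat M G′
      flatG′ = Mᵖ.cl-flat (G ∪ ⁅ x ⁆)
      x∈G′ : x ∈ G′
      x∈G′ = Mᵖ.⊆-cl _ (q⊆p∪q G _ (x∈⁅x⁆ x))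
      G⊆G′ : G ⊆ G′
      G⊆G′ y∈G = Mᵖ.⊆-cl _ (p⊆p∪q _ y∈G)
      G′⊆F : G′ ⊆ F
      G′⊆F = Mᵖ.cl-least flatF (∪-least G⊆F (⁅x⁆⊆p x∈F))
      rk[G′]+d≡rk[F] : rkᴹ G′ + d ≡ rkᴹ F
      rk[G′]+d≡rk[F] = begin-equality
        rkᴹ G′ + d           ≡⟨ cong (_+ d) (Mᵖ.rk-cl _) ⟩
        rkᴹ (G ∪ ⁅ x ⁆) + d  ≡⟨ cong (_+ d) (≤-antisym (Mᵖ.rk-∪⁅x⁆≤1+rk G x) (flatG x x∉G)) ⟩
        suc (rkᴹ G) + d      ≡⟨ +-suc (rkᴹ G) d ⟨
        rkᴹ G + suc d        ≡⟨ rk≡ ⟩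
        rkᴹ F                ∎
      φG′≢φG : φ G′ ≢ φ G
      φG′≢φG φG′≡φG = x∉G (subst (x ∈_) (injective G′ G flatG′ flatG φG′≡φG) x∈G′)

  rk-φ+rk≤rank : rank N ≡ rank M → ∀ {F} → Flat M F → rkᴺ (φ F) + rkᴹ F ≤ rank M
  rk-φ+rk≤rank rank≡ {F} flatF = begin
    rkᴺ (φ F) + rkᴹ F  ≤⟨ rk-φ-chain (rkᴹ F) (Mᵖ.cl-flat ⊥) flatF (Mᵖ.cl-least flatF (⊥⊆ {p = F})) rk[cl⊥]+rk≡rk ⟩
    rkᴺ (φ (Mᵖ.cl ⊥))  ≤⟨ rkᴺ-mono ⊆⊤ ⟩
    rank N             ≡⟨ rank≡ ⟩
    rank M             ∎
    where
    open ≤-Reasoning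
    rk[cl⊥]+rk≡rk : rkᴹ (Mᵖ.cl ⊥) + rkᴹ F ≡ rkᴹ F
    rk[cl⊥]+rk≡rk = cong (_+ rkᴹ F) (trans (Mᵖ.rk-cl ⊥) Mᵖ.rk[⊥]≡0)

  1≤rk-φ-hyperplane : ∀ {H} → Hyperplane M H → 1 ≤ rkᴺ (φ H)
  1≤rk-φ-hyperplane {H} (flatH , 1+rk[H]≡rank) = ≤-trans (m≤n+m 1 _)
    (rk-φ-chain 1 flatH Mᵖ.⊤-flat ⊆⊤ (trans (+-comm (rkᴹ H) 1) 1+rk[H]≡rank))

module FundamentalHyperplanesOfBasis
  {n m : ℕ} {M : Matroid n} {N : Matroid m}
  {h : Fin m → Subset n}
  (hyperplane : ∀ i → Hyperplane M (h i))
  (h-injective : ∀ i j → h i ≡ h j → i ≡ j)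
  (h-onto : ∀ H → Hyperplane M H → ∃[ i ] (h i ≡ H))
  {φ : Subset n → Subset m}
  (adjoint-via : IsAdjointVia M N φ)
  (φ∘h≡⁅⁆ : ∀ i → φ (h i) ≡ ⁅ i ⁆)
  {B : Subset n} (basis : Basis M B)
  {S : Subset m}
  (S⇔ : ∀ i → (i ∈ S) ⇔ (∃[ e ] (e ∈ B × IsFundHyp M B e (h i))))
  where

  open AdjointMap (proj₂ adjoint-via)
  open AdjointMapProperties (proj₂ adjoint-via)
  open Matroid M using () renaming (rk to rkᴹ; rk-mono to rkᴹ-mono)
  open Matroid N using () renaming (rk to rkᴺ; rk-mono to rkᴺ-mono; rk-bound to rkᴺ-bound)
  private
    module Mᵖ = MatroidProperties M
    module Nᵖ = MatroidProperties N

  fundamental : ∀ {i} → i ∈ S → ∃[ e ] (e ∈ B × IsFundHyp M B e (h i))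
  fundamental {i} = Equivalence.to (S⇔ i)

  ⋂h : Subset m → Subset n
  ⋂h = ⋂ᶠ h

  ⋂h-flat : ∀ K → Flat M (⋂h K)
  ⋂h-flat = Mᵖ.⋂ᶠ-flat (λ i → proj₁ (hyperplane i))

  ⊆φ⋂h : ∀ K → K ⊆ φ (⋂h K)
  ⊆φ⋂h K {k} k∈K = antitone (⋂h K) (h k) (⋂h-flat K) (proj₁ (hyperplane k)) (⋂ᶠ⊆ h k∈K)
    (subst (k ∈_) (sym (φ∘h≡⁅⁆ k)) (x∈⁅x⁆ k))

  rank≤rk[⋂h∩B]+∣∣ : ∀ {K} → K ⊆ S → rank M ≤ rkᴹ (⋂h K ∩ B) + ∣ K ∣
  rank≤rk[⋂h∩B]+∣∣ {K} K⊆S = subst (_≤ rkᴹ (⋂h K ∩ B) + ∣ K ∣) (proj₂ basis)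
    (Mᵖ.rk≤rk[⋂ᶠ∩]+∣∣ h B K λ k∈K → let (e , _ , _ , B-e⊆hk) = fundamental (K⊆S k∈K) in e , B-e⊆hk)

  rk-φ⋂h≤∣∣ : ∀ {K} → K ⊆ S → rkᴺ (φ (⋂h K)) ≤ ∣ K ∣
  rk-φ⋂h≤∣∣ {K} K⊆S = +-cancelʳ-≤ (rkᴹ (⋂h K)) _ _ (begin
    rkᴺ (φ (⋂h K)) + rkᴹ (⋂h K)  ≤⟨ rk-φ+rk≤rank (proj₁ adjoint-via) (⋂h-flat K) ⟩
    rank M                       ≤⟨ rank≤rk[⋂h∩B]+∣∣ K⊆S ⟩
    rkᴹ (⋂h K ∩ B) + ∣ K ∣       ≤⟨ +-monoˡ-≤ ∣ K ∣ (rkᴹ-mono (p∩q⊆p _ B)) ⟩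
    rkᴹ (⋂h K) + ∣ K ∣           ≡⟨ +-comm (rkᴹ (⋂h K)) ∣ K ∣ ⟩
    ∣ K ∣ + rkᴹ (⋂h K)           ∎)
    where open ≤-Reasoning

  fundamental-∈-⋂h : ∀ {i K} → i ∈ S → K ⊆ S → i ∉ K → ∃[ e ] (e ∉ h i × e ∈ ⋂h K)
  fundamental-∈-⋂h {i} {K} i∈S K⊆S i∉K with fundamental i∈S
  ... | e , e∈B , fundᵢ =
    e , Mᵖ.∉-fundamental-hyperplane (proj₂ basis) fundᵢ , ∈⋂ᶠ⁺ h {K} e∈hk
    where
    e∈hk : ∀ k → k ∈ K → e ∈ h k
    e∈hk k k∈K with fundamental (K⊆S k∈K)
    ... | eₖ , _ , fundₖ@(_ , B-eₖ⊆hk) = B-eₖ⊆hk (x∈p∧x≢y⇒x∈p-y e∈B e≢eₖ)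
      where
      e≢eₖ : e ≢ eₖ
      e≢eₖ refl = i∉K (subst (_∈ K) (sym (h-injective i k
        (Mᵖ.fundamental-hyperplane-unique (proj₂ basis) fundᵢ fundₖ))) k∈K)

  fundamental-index : ∀ {e} → e ∈ B → ∃[ i ] (i ∈ S × e ∉ h i)
  fundamental-index {e} e∈B with h-onto _ (proj₁ (Mᵖ.cl-fundamental-hyperplane basis e∈B))
  ... | i , hi≡cl = i , Equivalence.from (S⇔ i) (e , e∈B , fundᵢ) ,
                    Mᵖ.∉-fundamental-hyperplane (proj₂ basis) fundᵢ
    where
    fundᵢ : IsFundHyp M B e (h i)
    fundᵢ = subst (IsFundHyp M B e) (sym hi≡cl) (Mᵖ.cl-fundamental-hyperplane basis e∈B)

  φ⋂h-spans : ∀ {I i} → I ⊆ S → i ∈ I → ∣ I - i ∣ ≤ rkᴺ (I - i) → rkᴺ I ≤ ∣ I - i ∣ →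
    I ⊆ φ (⋂h (I - i)) × rkᴺ (φ (⋂h (I - i))) ≤ rkᴺ I
  φ⋂h-spans {I} {i} I⊆S i∈I ∣I-i∣≤rk rk≤∣I-i∣ =
    Nᵖ.rk≤⇒⊆-flat (flat↦flat _ (⋂h-flat (I - i))) (⊆φ⋂h (I - i)) I-i⊆I (≤-trans rk≤∣I-i∣ ∣I-i∣≤rk) ,
    ≤-trans (rk-φ⋂h≤∣∣ (λ k∈ → I⊆S (I-i⊆I k∈))) (≤-trans ∣I-i∣≤rk (rkᴺ-mono I-i⊆I))
    where
    I-i⊆I : I - i ⊆ I
    I-i⊆I = p─q⊆p I ⁅ i ⁆

  rk<∣∣-impossible : ∀ {I i j} → I ⊆ S → i ∈ I → j ∈ I - i →
    ∣ I - i ∣ ≤ rkᴺ (I - i) → ∣ I - j ∣ ≤ rkᴺ (I - j) → ¬ (rkᴺ I < ∣ I ∣)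
  rk<∣∣-impossible {I} {i} {j} I⊆S i∈I j∈I-i ∣I-i∣≤rk ∣I-j∣≤rk rk<∣I∣
    with fundamental-∈-⋂h (I⊆S i∈I) (λ k∈ → I⊆S (p─q⊆p I ⁅ i ⁆ k∈)) (λ i∈I-i → x∈p-y⇒x≢y i∈I-i refl)
  ... | e , e∉hi , e∈⋂h[I-i] = e∉hi (⋂ᶠ⊆ h i∈I-j (subst (e ∈_) ⋂h[I-i]≡⋂h[I-j] e∈⋂h[I-i]))
    where
    j∈I : j ∈ I
    j∈I = p─q⊆p I ⁅ i ⁆ j∈I-i
    i∈I-j : i ∈ I - j
    i∈I-j = x∈p∧x≢y⇒x∈p-y i∈I (λ i≡j → x∈p-y⇒x≢y j∈I-i (sym i≡j))
    spans : ∀ {k} → k ∈ I → ∣ I - k ∣ ≤ rkᴺ (I - k) → I ⊆ φ (⋂h (I - k)) × rkᴺ (φ (⋂h (I - k))) ≤ rkᴺ I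
    spans k∈I ∣I-k∣≤rk = φ⋂h-spans I⊆S k∈I ∣I-k∣≤rk (≤-pred (subst (rkᴺ I <_) (∣p∣≡1+∣p-x∣ I k∈I) rk<∣I∣))
    ⋂h[I-i]≡⋂h[I-j] : ⋂h (I - i) ≡ ⋂h (I - j)
    ⋂h[I-i]≡⋂h[I-j] with spans i∈I ∣I-i∣≤rk | spans j∈I ∣I-j∣≤rk
    ... | I⊆φᵢ , rk[φᵢ]≤ | I⊆φⱼ , rk[φⱼ]≤ = injective _ _ (⋂h-flat (I - i)) (⋂h-flat (I - j))
      (Nᵖ.flats-⊇-of-rk≤-unique (flat↦flat _ (⋂h-flat (I - i))) (flat↦flat _ (⋂h-flat (I - j)))
        I⊆φᵢ I⊆φⱼ rk[φᵢ]≤ rk[φⱼ]≤)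

  ∣∣≤rk : ∀ {I} → I ⊆ S → ∣ I ∣ ≤ rkᴺ I
  ∣∣≤rk {I} I⊆S = go _ I I⊆S refl
    where
    go : ∀ c I → I ⊆ S → ∣ I ∣ ≡ c → ∣ I ∣ ≤ rkᴺ I
    go zero I _ ∣I∣≡0 = ≤-trans (≤-reflexive ∣I∣≡0) z≤n
    go (suc zero) I _ ∣I∣≡1 with ∣p∣≡1+k⇒∃x∈p∣p-x∣≡k I ∣I∣≡1
    ... | i , i∈I , _ = begin
      ∣ I ∣              ≡⟨ ∣I∣≡1 ⟩
      1                  ≤⟨ 1≤rk-φ-hyperplane (hyperplane i) ⟩
      rkᴺ (φ (h i))      ≡⟨ cong rkᴺ (φ∘h≡⁅⁆ i) ⟩
      rkᴺ ⁅ i ⁆          ≤⟨ rkᴺ-mono (⁅x⁆⊆p i∈I) ⟩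
      rkᴺ I              ∎
      where open ≤-Reasoning
    go (suc (suc c)) I I⊆S ∣I∣≡2+c =
      let (i , i∈I , ∣I-i∣≡1+c) = ∣p∣≡1+k⇒∃x∈p∣p-x∣≡k I ∣I∣≡2+c
          (j , j∈I-i , _) = ∣p∣≡1+k⇒∃x∈p∣p-x∣≡k (I - i) ∣I-i∣≡1+c
          ∣I-j∣≡1+c = suc-injective (trans (sym (∣p∣≡1+∣p-x∣ I (p─q⊆p I _ j∈I-i))) ∣I∣≡2+c)
      in ≮⇒≥ (rk<∣∣-impossible I⊆S i∈I j∈I-i
           (go (suc c) (I - i) (λ k∈ → I⊆S (p─q⊆p I _ k∈)) ∣I-i∣≡1+c)
           (go (suc c) (I - j) (λ k∈ → I⊆S (p─q⊆p I _ k∈)) ∣I-j∣≡1+c))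

  rank≤∣S∣ : rank M ≤ ∣ S ∣
  rank≤∣S∣ = begin
    rank M                     ≤⟨ rank≤rk[⋂h∩B]+∣∣ ⊆-refl ⟩
    rkᴹ (⋂h S ∩ B) + ∣ S ∣     ≤⟨ +-monoˡ-≤ ∣ S ∣ (rkᴹ-mono ⋂h[S]∩B⊆⊥) ⟩
    rkᴹ ⊥ + ∣ S ∣              ≡⟨ cong (_+ ∣ S ∣) Mᵖ.rk[⊥]≡0 ⟩
    ∣ S ∣                      ∎
    where
    open ≤-Reasoning
    ⋂h[S]∩B⊆⊥ : ⋂h S ∩ B ⊆ ⊥
    ⋂h[S]∩B⊆⊥ x∈ with x∈p∩q⁻ (⋂h S) B x∈
    ... | x∈⋂h , x∈B with fundamental-index x∈B
    ...   | i , i∈S , x∉hi = ⊥-elim (x∉hi (⋂ᶠ⊆ h i∈S x∈⋂h))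

  S-basis : Basis N S
  S-basis = rk≡∣S∣ , ≤-antisym (rkᴺ-mono ⊆⊤) (begin
    rank N   ≡⟨ proj₁ adjoint-via ⟩
    rank M   ≤⟨ rank≤∣S∣ ⟩
    ∣ S ∣    ≡⟨ rk≡∣S∣ ⟨
    rkᴺ S    ∎)
    where
    open ≤-Reasoning
    rk≡∣S∣ : rkᴺ S ≡ ∣ S ∣
    rk≡∣S∣ = ≤-antisym (rkᴺ-bound S) (∣∣≤rk ⊆-refl)

lemma3p2 : {n m : ℕ} (M : Matroid (suc n)) (N : Matroid (suc m))
  -- identification E(N) = H(M) : h is a bijection from Fin (suc m) onto the hyperplanes of M
  (h : Fin (suc m) → Subset (suc n)) →
  (∀ i → Hyperplane M (h i)) →
  (∀ i j → h i ≡ h j → i ≡ j) →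
  (∀ H → Hyperplane M H → ∃[ i ] (h i ≡ H)) →
  -- an adjoint map φ with φ(H) = {H} for every hyperplane H
  (φ : Subset (suc n) → Subset (suc m)) →
  IsAdjointVia M N φ →
  (∀ i → φ (h i) ≡ ⁅ i ⁆) →
  (B : Subset (suc n)) → Basis M B →
  -- S = { H(e;B) | e ∈ B }, viewed as a subset of E(N)
  (S : Subset (suc m)) →
  (∀ i → (i ∈ S) ⇔ (∃[ e ] (e ∈ B × IsFundHyp M B e (h i)))) →
  Basis N S
lemma3p2 M N h hyperplane h-injective h-onto φ adjoint-via φ∘h≡⁅⁆ B basis S S⇔ =
  FundamentalHyperplanesOfBasis.S-basis hyperplane h-injective h-onto adjoint-via φ∘h≡⁅⁆ basis S⇔
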